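{- Let $H$ be a stacked triangulation and let $(x,y,z)$ be a face of $H$. Then three new vertices $a,b,c$ can be added inside $(x,y,z)$ (with new edges drawn inside this face) so that the resulting plane graph $G$ is a stacked triangulation with the following property: for every edge guard set $\Gamma$ of $G$ there is an edge guard set $\Gamma'$ of $G$ with $|\Gamma'| = |\Gamma|$ such that $x \in V(\Gamma')$ and $\Gamma'$ contains an edge $vw$ with $v \in \{x,y,z\}$ and $w \in \{a,b,c\}$.
   Context: A plane graph is a simple graph together with a crossing-free embedding in $\mathbb{R}^2$. Stacked triangulations are defined recursively: (i) a triangle (a plane $3$-cycle) is a stacked triangulation; (ii) if $G$ is a stacked triangulation and $f=(x,y,z)$ is an inner face, then the plane graph obtained by placing a new vertex $v$ inside $f$ and joining it to $x,y,z$ is a stacked triangulation; any plane embedding of such a graph is also regarded as a stacked triangulation. For a plane graph $G=(V,E)$, a face $f$ is guarded by an edge $vw \in E$ if at least one of $v,w$ lies on the boundary of $f$. A set $\Gamma \subseteq E$ is an edge guard set if every face of $G$ (including the outer face) is guarded by some edge of $\Gamma$. For $\Gamma \subseteq E$, $V(\Gamma)$ denotes the set of endpoints of edges in $\Gamma$. -}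

module Defs where

open import Data.Nat using (ℕ; suc; _<_; _+_)
open import Data.Product using (_×_; _,_; ∃; ∃-syntax)
open import Data.Sum using (_⊎_)
open import Data.List using (List; []; _∷_; _++_)
open import Data.List.Relation.Unary.All using (All)
open import Data.List.Relation.Unary.Any using (Any)
open import Data.List.Relation.Unary.Unique.Propositional using (Unique)
open import Data.List.Membership.Propositional using (_∈_)
open import Data.List.Relation.Binary.Permutation.Propositional using (_↭_)
open import Relation.Binary.PropositionalEquality using (_≡_)

-- A stacked triangulation (which is a maximal
-- plane graph, all of whose faces including the outer one are triangles, with
-- an embedding unique up to the choice of outer face) is represented
-- combinatorially by the list of its faces, each face being the triple of its
-- boundary vertices. The outer face is one entry of this list.

Tri : Set
Tri = ℕ × ℕ × ℕ

triList : Tri → List ℕ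
triList (p , q , r) = p ∷ q ∷ r ∷ []

_∈t_ : ℕ → Tri → Set
v ∈t (p , q , r) = v ≡ p ⊎ v ≡ q ⊎ v ≡ r

data Stack (v : ℕ) (F : List Tri) : List Tri → Set where
  stack : ∀ p q r R → F ↭ ((p , q , r) ∷ R) →
          Stack v F ((p , q , v) ∷ (q , r , v) ∷ (r , p , v) ∷ R)

-- Stacked n F : F is the face list of a stacked triangulation with vertex set
-- {0,…,n-1}. Base: a triangle (inner face and outer face both bounded by 0,1,2).
-- Stacking into the outer face yields the same plane graph as stacking into an
-- inner face and re-choosing the outer face, so any face may be used.
data Stacked : ℕ → List Tri → Set where
  triangle : Stacked 3 ((0 , 1 , 2) ∷ (0 , 1 , 2) ∷ [])
  step     : ∀ {n F F'} → Stacked n F → Stack n F F' → Stacked (suc n) F'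

-- Edges, stored normalised as (v , w) with v < w; the edges of a stacked
-- triangulation are exactly the pairs of vertices sharing a face.
Edge : Set
Edge = ℕ × ℕ

IsEdge : List Tri → Edge → Set
IsEdge F (v , w) = v < w × Any (λ t → v ∈t t × w ∈t t) F

Guards : Tri → Edge → Set
Guards t (v , w) = v ∈t t ⊎ w ∈t t

-- Γ (a duplicate-free list of edges of G, so |Γ| = length Γ) is an edge guard set
-- of the plane graph with face list F: every face is guarded by some edge of Γ.
EdgeGuardSet : List Tri → List Edge → Set
EdgeGuardSet F Γ = Unique Γ × All (IsEdge F) Γ × All (λ t → Any (Guards t) Γ) F

_∈V_ : ℕ → List Edge → Set
u ∈V Γ = ∃[ w ] ((u , w) ∈ Γ ⊎ (w , u) ∈ Γ)

-- G (face list) is obtained from a stacked triangulation whose face list is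
-- t ∷ R by adding the three new vertices n, n+1, n+2 inside face t, all new
-- edges drawn inside t: the face t is replaced by a stacked triangulation D of t.
AddThreeInside : ℕ → Tri → List Tri → List Tri → Set
AddThreeInside n t R G =
  ∃[ D₁ ] ∃[ D₂ ] ∃[ D₃ ]
    (Stack n (t ∷ []) D₁ × Stack (suc n) D₁ D₂ × Stack (suc (suc n)) D₂ D₃
     × G ≡ D₃ ++ R)

-- Rotate the face to (X,Y,Z) with X = x and let a, b, c be the new vertices
-- n, n+1, n+2: stack a into (X,Y,Z), b into (X,Y,a) and c into (a,X,b). The
-- edge Xa touches every new face, X, Y, Z are the only old neighbours of
-- a, b, c, and X is the only old neighbour of c. Let Γ be an edge guard set.
-- If Xa ∈ Γ keep Γ. Otherwise the all-new face (b,a,c) has a guard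
-- e₁ = (v₁,w₁) with w₁ new; trade e₁ for Xa unless v₁ is old, ≠ X and on no
-- other edge, whence v₁ ∈ {Y,Z}. Then keep Γ if X ∈ V(Γ); otherwise the faces
-- (a,X,c), (X,b,c) force a second edge e₂ = (v₂,w₂) with w₂ new: trade e₂ for
-- Xa if v₂ is new, else v₂ ∈ {Y,Z} and trade e₁, e₂ for YZ and Xa. Trades
-- keep old faces guarded since old endpoints of traded edges stay covered.

module Submission where

open import Defs
open import Data.Nat using (ℕ; suc; _+_; _<_; _≤_; z≤n; s≤s)
open import Data.Nat.Properties
  using (_≟_; _<?_; <-cmp; <-irrefl; ≤-refl; n≤1+n; m<n⇒m<1+n; <⇒≢; +-comm; ≤-trans; <⇒≤; ≤⇒≯)
open import Data.Product using (_×_; _,_; ∃-syntax; ∃₂; proj₁; proj₂)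
open import Data.Product.Properties using (≡-dec)
open import Data.Sum using (_⊎_; inj₁; inj₂)
open import Data.Empty using (⊥-elim)
open import Function using (_∘_)
open import Data.List using (List; []; _∷_; length; _++_; [_])
open import Data.List.Properties using (length-++)
open import Data.List.Relation.Unary.All using (All; []; _∷_)
import Data.List.Relation.Unary.All as All
import Data.List.Relation.Unary.All.Properties as AllP
open import Data.List.Relation.Unary.Any using (Any; here; there; any?)
import Data.List.Relation.Unary.Any as Any
import Data.List.Relation.Unary.Any.Properties as AnyP
open import Data.List.Membership.Propositional using (_∈_; _∉_; find; lose)
open import Data.List.Membership.Propositional.Properties using (∈-∃++; ∈-++⁻)
open import Data.List.Relation.Unary.Unique.Propositional using (Unique)
open import Data.List.Relation.Unary.AllPairs using ([]; _∷_)
import Data.List.Relation.Unary.Unique.Propositional.Properties as UniqueP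
open import Data.List.Relation.Binary.Disjoint.Propositional using (Disjoint)
open import Data.List.Relation.Binary.Permutation.Propositional
  using (_↭_; ↭-sym; ↭-trans; ↭-refl; ↭-prep; ↭-swap; ↭⇒↭ₛ)
open import Data.List.Relation.Binary.Permutation.Propositional.Properties
  using (All-resp-↭; Any-resp-↭; ∈-resp-↭; ↭-length; shift; ++⁺ʳ)
import Data.List.Relation.Binary.Permutation.Setoid.Properties as PermSetoid
open import Relation.Binary.PropositionalEquality
  using (_≡_; refl; sym; trans; cong; subst; _≢_; setoid; module ≡-Reasoning)
open import Relation.Binary.Definitions using (tri<; tri≈; tri>)
open import Relation.Nullary using (¬_; yes; no; Dec)
open import Relation.Nullary.Decidable using (_⊎-dec_)

Touch : ℕ → Edge → Set
Touch s (v , w) = s ≡ v ⊎ s ≡ w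

touch? : ∀ s e → Dec (Touch s e)
touch? s (v , w) = (s ≟ v) ⊎-dec (s ≟ w)

_≟e_ : (e f : Edge) → Dec (e ≡ f)
_≟e_ = ≡-dec _≟_ _≟_

touch⇒guards : ∀ {s t} e → s ∈t t → Touch s e → Guards t e
touch⇒guards (v , w) s∈t (inj₁ refl) = inj₁ s∈t
touch⇒guards (v , w) s∈t (inj₂ refl) = inj₂ s∈t

guards⇒touch : ∀ {t} e → Guards t e → ∃[ s ] (s ∈t t × Touch s e)
guards⇒touch (v , w) (inj₁ v∈t) = v , v∈t , inj₁ refl
guards⇒touch (v , w) (inj₂ w∈t) = w , w∈t , inj₂ refl

endpoint : ∀ {s Γ} → Any (Touch s) Γ → s ∈V Γ
endpoint t with find t
... | (v , w) , e∈Γ , inj₁ refl = w , inj₁ e∈Γ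
... | (v , w) , e∈Γ , inj₂ refl = v , inj₂ e∈Γ

touch-new : ∀ {n u v w} → v < w → n ≤ u → Touch u (v , w) → n ≤ w
touch-new v<w n≤u (inj₁ refl) = ≤-trans n≤u (<⇒≤ v<w)
touch-new v<w n≤u (inj₂ refl) = n≤u

touch-old : ∀ {n u v w} → v < n → n ≤ u → Touch u (v , w) → w ≡ u
touch-old v<n n≤u (inj₁ refl) = ⊥-elim (≤⇒≯ n≤u v<n)
touch-old v<n n≤u (inj₂ refl) = refl

touch-new-⊎ : ∀ {n u u′ v w} → v < w → n ≤ u → n ≤ u′ → Touch u (v , w) ⊎ Touch u′ (v , w) → n ≤ w
touch-new-⊎ v<w n≤u _ (inj₁ u-e) = touch-new v<w n≤u u-e
touch-new-⊎ v<w _ n≤u′ (inj₂ u′-e) = touch-new v<w n≤u′ u′-e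

onFace : ∀ {P : ℕ → Set} {p q r} → P p → P q → P r → ∀ v → v ∈t (p , q , r) → P v
onFace Pp Pq Pr v (inj₁ refl) = Pp
onFace Pp Pq Pr v (inj₂ (inj₁ refl)) = Pq
onFace Pp Pq Pr v (inj₂ (inj₂ refl)) = Pr

extract : ∀ {A : Set} {xs : List A} {x} → x ∈ xs → ∃[ ys ] (xs ↭ x ∷ ys)
extract x∈xs with ∈-∃++ x∈xs
... | ys , zs , refl = ys ++ zs , shift _ ys zs

∈-tail : ∀ {A : Set} {xs ys : List A} {x y} → xs ↭ x ∷ ys → y ∈ xs → y ≢ x → y ∈ ys
∈-tail xs↭ y∈xs y≢x with ∈-resp-↭ xs↭ y∈xs
... | here y≡x = ⊥-elim (y≢x y≡x)
... | there y∈ys = y∈ys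

Unique-++⁻ʳ : ∀ {A : Set} (xs : List A) {ys} → Unique (xs ++ ys) → Unique ys
Unique-++⁻ʳ [] u = u
Unique-++⁻ʳ (x ∷ xs) (_ ∷ u) = Unique-++⁻ʳ xs u

OldFace : ℕ → Tri → Set
OldFace n t = ∀ v → v ∈t t → v < n

OldEndsIn : ℕ → List Edge → Edge → Set
OldEndsIn n L e = ∀ v → Touch v e → v < n → Any (Touch v) L

oldEnds-new : ∀ {n L v w} → n ≤ w → (v < n → Any (Touch v) L) → OldEndsIn n L (v , w)
oldEnds-new n≤w covered u (inj₁ refl) u<n = covered u<n
oldEnds-new n≤w covered u (inj₂ refl) u<n = ⊥-elim (≤⇒≯ n≤w u<n)

-- The faces
-- of D must be guarded by Fs; a face of R (only old vertices) guarded by a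
-- removed edge through an old vertex stays guarded as that vertex is still
-- covered.
replaceEdges : ∀ n (D R : List Tri) {Γ Es Γ₀ Fs : List Edge} →
  EdgeGuardSet (D ++ R) Γ → Γ ↭ Es ++ Γ₀ → length Fs ≡ length Es →
  Unique Fs → Disjoint Fs Γ₀ → All (IsEdge (D ++ R)) Fs →
  All (λ t → Any (Guards t) Fs) D → All (OldFace n) R →
  All (OldEndsIn n (Fs ++ Γ₀)) Es →
  EdgeGuardSet (D ++ R) (Fs ++ Γ₀) × length (Fs ++ Γ₀) ≡ length Γ
replaceEdges n D R {Γ} {Es} {Γ₀} {Fs} (unique , edges , guarded) Γ↭
             |Fs| uniqueFs fresh edgesFs guardsD oldR oldEnds =
  (UniqueP.++⁺ uniqueFs uniqueΓ₀ fresh ,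
   AllP.++⁺ edgesFs (AllP.++⁻ʳ Es (All-resp-↭ Γ↭ edges)) ,
   AllP.++⁺ (All.map AnyP.++⁺ˡ guardsD)
            (All.zipWith reguard (oldR , AllP.++⁻ʳ D guarded))) ,
  sameLength
  where
  uniqueΓ₀ : Unique Γ₀
  uniqueΓ₀ = Unique-++⁻ʳ Es (PermSetoid.Unique-resp-↭ (setoid Edge) (↭⇒↭ₛ Γ↭) unique)

  reguard : ∀ {t} → OldFace n t × Any (Guards t) Γ → Any (Guards t) (Fs ++ Γ₀)
  reguard (old , guard) with AnyP.++⁻ Es (Any-resp-↭ Γ↭ guard)
  ... | inj₂ guard₀ = AnyP.++⁺ʳ Fs guard₀
  ... | inj₁ guardEs with find guardEs
  ... | e , e∈Es , g with guards⇒touch e g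
  ... | s , s∈t , s-e = Any.map (λ {f} → touch⇒guards f s∈t)
                                 (All.lookup oldEnds e∈Es s s-e (old s s∈t))

  sameLength : length (Fs ++ Γ₀) ≡ length Γ
  sameLength = begin
    length (Fs ++ Γ₀)          ≡⟨ length-++ Fs ⟩
    length Fs + length Γ₀      ≡⟨ cong (_+ length Γ₀) |Fs| ⟩
    length Es + length Γ₀      ≡⟨ sym (length-++ Es) ⟩
    length (Es ++ Γ₀)          ≡⟨ sym (↭-length Γ↭) ⟩
    length Γ                   ∎
    where open ≡-Reasoning

WellFormed : ℕ → Tri → Set
WellFormed n (p , q , r) = p < n × q < n × r < n × p ≢ q × q ≢ r × p ≢ r

wellFormed⇒old : ∀ {n} t → WellFormed n t → OldFace n t
wellFormed⇒old (p , q , r) (p<n , q<n , r<n , _) = onFace p<n q<n r<n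

wellFormed-suc : ∀ {n} t → WellFormed n t → WellFormed (suc n) t
wellFormed-suc (p , q , r) (p<n , q<n , r<n , distinct) =
  m<n⇒m<1+n p<n , m<n⇒m<1+n q<n , m<n⇒m<1+n r<n , distinct

wellFormed-step : ∀ {n F F'} → All (WellFormed n) F → Stack n F F' → All (WellFormed (suc n)) F'
wellFormed-step {n} wf (stack p q r R F↭) with All-resp-↭ F↭ wf
... | (p<n , q<n , r<n , p≢q , q≢r , p≢r) ∷ wfR =
  (up p<n , up q<n , ≤-refl , p≢q , <⇒≢ q<n , <⇒≢ p<n) ∷
  (up q<n , up r<n , ≤-refl , q≢r , <⇒≢ r<n , <⇒≢ q<n) ∷
  (up r<n , up p<n , ≤-refl , p≢r ∘ sym , <⇒≢ p<n , <⇒≢ r<n) ∷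
  All.map (λ {t} → wellFormed-suc t) wfR
  where
  up : ∀ {m} → m < n → m < suc n
  up = m<n⇒m<1+n

wellFormed : ∀ {n F} → Stacked n F → All (WellFormed n) F
wellFormed triangle = wf ∷ wf ∷ []
  where
  wf : WellFormed 3 (0 , 1 , 2)
  wf = s≤s z≤n , s≤s (s≤s z≤n) , s≤s (s≤s (s≤s z≤n)) , (λ ()) , (λ ()) , (λ ())
wellFormed (step s st) = wellFormed-step (wellFormed s) st

stackFaces : ℕ → Tri → List Tri
stackFaces v (p , q , r) = (p , q , v) ∷ (q , r , v) ∷ (r , p , v) ∷ []

stack-into : ∀ v t → Stack v (t ∷ []) (stackFaces v t)
stack-into v (p , q , r) = stack p q r [] ↭-refl

Stack-++ : ∀ {v F F'} R → Stack v F F' → Stack v (F ++ R) (F' ++ R)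
Stack-++ R (stack p q r R₀ F↭) = stack p q r (R₀ ++ R) (++⁺ʳ R F↭)

Stack-resp-↭ : ∀ {v F₀ F F'} → F₀ ↭ F → Stack v F F' → Stack v F₀ F'
Stack-resp-↭ F₀↭ (stack p q r R F↭) = stack p q r R (↭-trans F₀↭ F↭)

data Rotation : Tri → Tri → Set where
  rot₀ : ∀ {p q r} → Rotation (p , q , r) (p , q , r)
  rot₁ : ∀ {p q r} → Rotation (p , q , r) (q , r , p)
  rot₂ : ∀ {p q r} → Rotation (p , q , r) (r , p , q)

rotateTo : ∀ {u} t → u ∈t t → ∃₂ λ v w → Rotation t (u , v , w)
rotateTo (p , q , r) (inj₁ refl) = q , r , rot₀
rotateTo (p , q , r) (inj₂ (inj₁ refl)) = r , p , rot₁
rotateTo (p , q , r) (inj₂ (inj₂ refl)) = p , q , rot₂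

rotation-vertex : ∀ {s t u} → Rotation t s → u ∈t s → u ∈t t
rotation-vertex rot₀ u∈s = u∈s
rotation-vertex rot₁ (inj₁ u≡q) = inj₂ (inj₁ u≡q)
rotation-vertex rot₁ (inj₂ (inj₁ u≡r)) = inj₂ (inj₂ u≡r)
rotation-vertex rot₁ (inj₂ (inj₂ u≡p)) = inj₁ u≡p
rotation-vertex rot₂ (inj₁ u≡r) = inj₂ (inj₂ u≡r)
rotation-vertex rot₂ (inj₂ (inj₁ u≡p)) = inj₁ u≡p
rotation-vertex rot₂ (inj₂ (inj₂ u≡q)) = inj₂ (inj₁ u≡q)

rotation-wellFormed : ∀ {n s t} → Rotation t s → WellFormed n t → WellFormed n s
rotation-wellFormed rot₀ wf = wf
rotation-wellFormed rot₁ (p<n , q<n , r<n , p≢q , q≢r , p≢r) =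
  q<n , r<n , p<n , q≢r , p≢r ∘ sym , p≢q ∘ sym
rotation-wellFormed rot₂ (p<n , q<n , r<n , p≢q , q≢r , p≢r) =
  r<n , p<n , q<n , p≢r ∘ sym , p≢q , q≢r ∘ sym

rotation-stackFaces : ∀ {v s t} → Rotation t s → stackFaces v t ↭ stackFaces v s
rotation-stackFaces rot₀ = ↭-refl
rotation-stackFaces rot₁ = ↭-sym (shift _ (_ ∷ _ ∷ []) [])
rotation-stackFaces rot₂ = shift _ (_ ∷ _ ∷ []) []

∈t⇒∈ : ∀ {u} t → u ∈t t → u ∈ triList t
∈t⇒∈ (p , q , r) (inj₁ e) = here e
∈t⇒∈ (p , q , r) (inj₂ (inj₁ e)) = there (here e)
∈t⇒∈ (p , q , r) (inj₂ (inj₂ e)) = there (there (here e))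

∈⇒∈t : ∀ {u} t → u ∈ triList t → u ∈t t
∈⇒∈t (p , q , r) (here e) = inj₁ e
∈⇒∈t (p , q , r) (there (here e)) = inj₂ (inj₁ e)
∈⇒∈t (p , q , r) (there (there (here e))) = inj₂ (inj₂ e)

-- The conclusion of the theorem for a guard set Γ of G, for a face with
-- vertex predicate T, distinguished vertex x and new vertices n, n+1, n+2.
Improvable : ℕ → ℕ → (ℕ → Set) → List Tri → List Edge → Set
Improvable n x T G Γ =
  ∃[ Γ' ] (EdgeGuardSet G Γ' × length Γ' ≡ length Γ × x ∈V Γ' ×
    ∃[ v ] ∃[ w ] (T v × w ∈t (n , suc n , suc (suc n)) × ((v , w) ∈ Γ' ⊎ (w , v) ∈ Γ')))

Improvable-mono : ∀ {n x G Γ} {T T' : ℕ → Set} → (∀ {u} → T u → T' u) →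
                  Improvable n x T G Γ → Improvable n x T' G Γ
Improvable-mono T⇒T' (Γ' , egs , len , x∈ , v , w , Tv , w-new , vw∈) =
  Γ' , egs , len , x∈ , v , w , T⇒T' Tv , w-new , vw∈

module Configuration (n X Y Z : ℕ) where

  a b c : ℕ
  a = n
  b = suc n
  c = suc (suc n)

  -- the faces after stacking b into (X,Y,a), and then c into (a,X,b)
  D₂ D : List Tri
  D₂ = (X , Y , b) ∷ (Y , a , b) ∷ (a , X , b) ∷ (Y , Z , a) ∷ (Z , X , a) ∷ []
  D = (a , X , c) ∷ (X , b , c) ∷ (b , a , c) ∷ (X , Y , b) ∷ (Y , a , b) ∷ (Y , Z , a) ∷ (Z , X , a) ∷ []

  stack-b : ∀ {D₁} → D₁ ↭ stackFaces a (X , Y , Z) → Stack b D₁ D₂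
  stack-b D₁↭ = stack X Y a _ D₁↭

  stack-c : Stack c D₂ D
  stack-c = stack a X b _ (shift _ ((X , Y , b) ∷ (Y , a , b) ∷ []) _)

  inner-new : ∀ {w} → w ∈t (a , b , c) → n ≤ w
  inner-new {w} = onFace {P = n ≤_} ≤-refl (n≤1+n n) (≤-trans (n≤1+n n) (n≤1+n (suc n))) w

  module Guarding (R : List Tri) (X<n : X < n) (Y<n : Y < n) (Z<n : Z < n) (Y≢Z : Y ≢ Z)
                  (oldR : All (OldFace n) R) where

    G : List Tri
    G = D ++ R

    Corner : ℕ → Set
    Corner u = u ∈t (X , Y , Z)

    Inner : ℕ → Set
    Inner w = w ∈t (a , b , c)

    isX : Corner X
    isX = inj₁ refl
    isY : Corner Y
    isY = inj₂ (inj₁ refl)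
    isZ : Corner Z
    isZ = inj₂ (inj₂ refl)
    isA : Inner a
    isA = inj₁ refl
    isB : Inner b
    isB = inj₂ (inj₁ refl)
    isC : Inner c
    isC = inj₂ (inj₂ refl)

    corner-old : ∀ {u} → Corner u → u < n
    corner-old {u} = onFace {P = _< n} X<n Y<n Z<n u

    c≢old : ∀ {u} → u < n → c ≢ u
    c≢old u<n c≡u = ≤⇒≯ (inner-new isC) (subst (_< n) (sym c≡u) u<n)

    c≢a : c ≢ a
    c≢a c≡a = <-irrefl (sym c≡a) (n≤1+n (suc n))

    c≢b : c ≢ b
    c≢b c≡b = <-irrefl (sym c≡b) ≤-refl

    FaceShape : Tri → Set
    FaceShape t = (∀ v → v ∈t t → Corner v ⊎ Inner v) × (c ∈t t → ∀ v → v ∈t t → v ≡ X ⊎ Inner v)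

    shapes : All FaceShape D
    shapes = (onFace (inj₂ isA) (inj₁ isX) (inj₂ isC) , λ _ → onFace (inj₂ isA) (inj₁ refl) (inj₂ isC))
           ∷ (onFace (inj₁ isX) (inj₂ isB) (inj₂ isC) , λ _ → onFace (inj₁ refl) (inj₂ isB) (inj₂ isC))
           ∷ (onFace (inj₂ isB) (inj₂ isA) (inj₂ isC) , λ _ → onFace (inj₂ isB) (inj₂ isA) (inj₂ isC))
           ∷ (onFace (inj₁ isX) (inj₁ isY) (inj₂ isB) , avoidsC (c≢old X<n) (c≢old Y<n) c≢b)
           ∷ (onFace (inj₁ isY) (inj₂ isA) (inj₂ isB) , avoidsC (c≢old Y<n) c≢a c≢b)
           ∷ (onFace (inj₁ isY) (inj₁ isZ) (inj₂ isA) , avoidsC (c≢old Y<n) (c≢old Z<n) c≢a)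
           ∷ (onFace (inj₁ isZ) (inj₁ isX) (inj₂ isA) , avoidsC (c≢old Z<n) (c≢old X<n) c≢a)
           ∷ []
      where
      avoidsC : ∀ {p q r} → c ≢ p → c ≢ q → c ≢ r → c ∈t (p , q , r) →
                ∀ v → v ∈t (p , q , r) → v ≡ X ⊎ Inner v
      avoidsC c≢p c≢q c≢r c∈t = ⊥-elim (onFace {P = c ≢_} c≢p c≢q c≢r c c∈t refl)

    newEdge : ∀ {v w} → IsEdge G (v , w) → n ≤ w →
              Inner w × (v < n → Corner v) × (w ≡ c → v < n → v ≡ X)
    newEdge {v} {w} (_ , onSomeFace) n≤w with find onSomeFace
    ... | t , t∈G , v∈t , w∈t with ∈-++⁻ D t∈G
    ... | inj₂ t∈R = ⊥-elim (≤⇒≯ n≤w (All.lookup oldR t∈R _ w∈t))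
    ... | inj₁ t∈D with All.lookup shapes t∈D
    ... | vertices , throughC =
      inner (vertices _ w∈t) , corner (vertices _ v∈t) ,
      λ { refl v<n → onlyX (throughC w∈t _ v∈t) v<n }
      where
      inner : Corner w ⊎ Inner w → Inner w
      inner (inj₁ w-corner) = ⊥-elim (≤⇒≯ n≤w (corner-old w-corner))
      inner (inj₂ w-inner) = w-inner
      corner : Corner v ⊎ Inner v → v < n → Corner v
      corner (inj₁ v-corner) _ = v-corner
      corner (inj₂ v-inner) v<n = ⊥-elim (≤⇒≯ (inner-new v-inner) v<n)
      onlyX : v ≡ X ⊎ Inner v → v < n → v ≡ X
      onlyX (inj₁ v≡X) _ = v≡X
      onlyX (inj₂ v-inner) v<n = ⊥-elim (≤⇒≯ (inner-new v-inner) v<n)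

    Xa : Edge
    Xa = (X , a)

    Xa-edge : IsEdge G Xa
    Xa-edge = X<n , here (inj₂ (inj₁ refl) , inj₁ refl)

    Xa-guards-D : All (λ t → Any (Guards t) [ Xa ]) D
    Xa-guards-D = here (inj₂ (inj₁ refl)) ∷ here (inj₁ (inj₁ refl)) ∷ here (inj₂ (inj₂ (inj₁ refl)))
                ∷ here (inj₁ (inj₁ refl)) ∷ here (inj₂ (inj₂ (inj₁ refl))) ∷ here (inj₂ (inj₂ (inj₂ refl)))
                ∷ here (inj₁ (inj₂ (inj₁ refl))) ∷ []

    at-YZa : ∀ {P : Tri → Set} → P (Y , Z , a) → Any P G
    at-YZa = there ∘ there ∘ there ∘ there ∘ there ∘ here

    YZ-exists : ∃[ f ] (IsEdge G f × proj₂ f < n × (∀ {u} → u ≡ Y ⊎ u ≡ Z → Touch u f))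
    YZ-exists with <-cmp Y Z
    ... | tri< Y<Z _ _ = (Y , Z) , (Y<Z , at-YZa (inj₁ refl , inj₂ (inj₁ refl))) , Z<n , λ u∈ → u∈
    ... | tri≈ _ Y≡Z _ = ⊥-elim (Y≢Z Y≡Z)
    ... | tri> _ _ Z<Y = (Z , Y) , (Z<Y , at-YZa (inj₂ (inj₁ refl) , inj₁ refl)) , Y<n , swap
      where
      swap : ∀ {u} → u ≡ Y ⊎ u ≡ Z → Touch u (Z , Y)
      swap (inj₁ u≡Y) = inj₂ u≡Y
      swap (inj₂ u≡Z) = inj₁ u≡Z

    YZ : Edge
    YZ = proj₁ YZ-exists

    YZ-edge : IsEdge G YZ
    YZ-edge = proj₁ (proj₂ YZ-exists)

    YZ-old : proj₂ YZ < n
    YZ-old = proj₁ (proj₂ (proj₂ YZ-exists))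

    YZ-touch : ∀ {u} → u ≡ Y ⊎ u ≡ Z → Touch u YZ
    YZ-touch = proj₂ (proj₂ (proj₂ YZ-exists))

    keep : ∀ Γ → EdgeGuardSet G Γ → Any (Touch X) Γ →
           ∀ {v w} → (v , w) ∈ Γ → Corner v → Inner w → Improvable n X Corner G Γ
    keep Γ egs X-in e∈Γ corner inner = Γ , egs , refl , endpoint X-in , _ , _ , corner , inner , inj₁ e∈Γ

    replaceOne : ∀ Γ → EdgeGuardSet G Γ → Xa ∉ Γ → ∀ e Γ₁ → Γ ↭ e ∷ Γ₁ →
                 OldEndsIn n (Xa ∷ Γ₁) e → Improvable n X Corner G Γ
    replaceOne Γ egs Xa∉Γ e Γ₁ Γ↭ oldEnds =
      Xa ∷ Γ₁ , proj₁ replaced , proj₂ replaced , (a , inj₁ (here refl)) , X , a , isX , isA , inj₁ (here refl)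
      where
      fresh : Disjoint [ Xa ] Γ₁
      fresh (here refl , Xa∈Γ₁) = Xa∉Γ (∈-resp-↭ (↭-sym Γ↭) (there Xa∈Γ₁))
      replaced : EdgeGuardSet G (Xa ∷ Γ₁) × length (Xa ∷ Γ₁) ≡ length Γ
      replaced = replaceEdges n D R egs Γ↭ refl ([] ∷ []) fresh (Xa-edge ∷ []) Xa-guards-D oldR (oldEnds ∷ [])

    replaceTwo : ∀ Γ → EdgeGuardSet G Γ → Xa ∉ Γ → YZ ∉ Γ → ∀ e₁ e₂ Γ₂ → Γ ↭ e₁ ∷ e₂ ∷ Γ₂ →
                 All (OldEndsIn n (YZ ∷ Xa ∷ Γ₂)) (e₁ ∷ e₂ ∷ []) → Improvable n X Corner G Γ
    replaceTwo Γ egs Xa∉Γ YZ∉Γ e₁ e₂ Γ₂ Γ↭ oldEnds =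
      YZ ∷ Xa ∷ Γ₂ , proj₁ replaced , proj₂ replaced , (a , inj₁ (there (here refl))) ,
      X , a , isX , isA , inj₁ (there (here refl))
      where
      YZ≢Xa : YZ ≢ Xa
      YZ≢Xa YZ≡Xa = <-irrefl (cong proj₂ YZ≡Xa) YZ-old
      inΓ : ∀ {g} → g ∈ Γ₂ → g ∈ Γ
      inΓ g∈Γ₂ = ∈-resp-↭ (↭-sym Γ↭) (there (there g∈Γ₂))
      fresh : Disjoint (YZ ∷ Xa ∷ []) Γ₂
      fresh (here refl , YZ∈Γ₂) = YZ∉Γ (inΓ YZ∈Γ₂)
      fresh (there (here refl) , Xa∈Γ₂) = Xa∉Γ (inΓ Xa∈Γ₂)
      replaced : EdgeGuardSet G (YZ ∷ Xa ∷ Γ₂) × length (YZ ∷ Xa ∷ Γ₂) ≡ length Γ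
      replaced = replaceEdges n D R egs Γ↭ refl ((YZ≢Xa ∷ []) ∷ [] ∷ []) fresh
                              (YZ-edge ∷ Xa-edge ∷ []) (All.map there Xa-guards-D) oldR oldEnds

    guard-bac : ∀ {v w} → v < w → Guards (b , a , c) (v , w) → n ≤ w
    guard-bac v<w g with guards⇒touch _ g
    ... | s , s∈bac , s-e =
      touch-new v<w (onFace {P = n ≤_} (inner-new isB) (inner-new isA) (inner-new isC) s s∈bac) s-e

    avoidX-aXc : ∀ e → Guards (a , X , c) e → ¬ Touch X e → Touch a e ⊎ Touch c e
    avoidX-aXc e g X∉e with guards⇒touch e g
    ... | s , inj₁ refl , s-e = inj₁ s-e
    ... | s , inj₂ (inj₁ refl) , s-e = ⊥-elim (X∉e s-e)
    ... | s , inj₂ (inj₂ refl) , s-e = inj₂ s-e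

    avoidX-Xbc : ∀ e → Guards (X , b , c) e → ¬ Touch X e → Touch b e ⊎ Touch c e
    avoidX-Xbc e g X∉e with guards⇒touch e g
    ... | s , inj₁ refl , s-e = ⊥-elim (X∉e s-e)
    ... | s , inj₂ (inj₁ refl) , s-e = inj₁ s-e
    ... | s , inj₂ (inj₂ refl) , s-e = inj₂ s-e

    endsAtC : ∀ {v w} → v < n → Touch a (v , w) ⊎ Touch c (v , w) →
              Touch b (v , w) ⊎ Touch c (v , w) → w ≡ c
    endsAtC v<n _ (inj₂ c-e) = touch-old v<n (inner-new isC) c-e
    endsAtC v<n (inj₂ c-e) _ = touch-old v<n (inner-new isC) c-e
    endsAtC v<n (inj₁ a-e) (inj₁ b-e) =
      ⊥-elim (<-irrefl (trans (sym (touch-old v<n (inner-new isA) a-e))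
                              (touch-old v<n (inner-new isB) b-e)) ≤-refl)

    -- If X is not covered by Γ, then besides an edge e₁ ∈ Γ whose smaller
    -- endpoint is old and not X, Γ has a second edge with new larger endpoint:
    -- (a,X,c) and (X,b,c) are guarded through a or c, resp. b or c, and e₁
    -- cannot guard both, since it would end at c, whose only corner neighbour is X.
    secondInnerEdge : ∀ Γ → EdgeGuardSet G Γ → ¬ Any (Touch X) Γ →
                      ∀ {v₁ w₁} → (v₁ , w₁) ∈ Γ → v₁ < n → v₁ ≢ X →
                      ∃[ e ] (e ∈ Γ × e ≢ (v₁ , w₁) × n ≤ proj₂ e)
    secondInnerEdge Γ (_ , edges , guarded) X∉Γ {v₁} {w₁} e₁∈Γ v₁<n v₁≢X
      with find (All.lookup guarded (here refl)) | find (All.lookup guarded (there (here refl)))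
    ... | (v , w) , e∈Γ , g | (v′ , w′) , f∈Γ , h
      with avoidX-aXc _ g (X∉Γ ∘ lose e∈Γ) | avoidX-Xbc _ h (X∉Γ ∘ lose f∈Γ)
         | (v , w) ≟e (v₁ , w₁) | (v′ , w′) ≟e (v₁ , w₁)
    ... | ac | _ | no e≢e₁ | _ =
      _ , e∈Γ , e≢e₁ , touch-new-⊎ (proj₁ (All.lookup edges e∈Γ)) (inner-new isA) (inner-new isC) ac
    ... | _ | bc | _ | no f≢e₁ =
      _ , f∈Γ , f≢e₁ , touch-new-⊎ (proj₁ (All.lookup edges f∈Γ)) (inner-new isB) (inner-new isC) bc
    ... | ac | bc | yes refl | yes refl with endsAtC v₁<n ac bc
    ... | refl = ⊥-elim (v₁≢X (proj₂ (proj₂ (newEdge (All.lookup edges e₁∈Γ) (inner-new isC))) refl v₁<n))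

    cornerYZ : ∀ Γ → EdgeGuardSet G Γ → ∀ {v w} → (v , w) ∈ Γ → n ≤ w → v < n → v ≢ X → v ≡ Y ⊎ v ≡ Z
    cornerYZ Γ (_ , edges , _) e∈Γ n≤w v<n v≢X
      with proj₁ (proj₂ (newEdge (All.lookup edges e∈Γ) n≤w)) v<n
    ... | inj₁ v≡X = ⊥-elim (v≢X v≡X)
    ... | inj₂ v∈YZ = v∈YZ

    YZ∉ : ∀ {Γ v₁ w₁ Γ₁} → Γ ↭ (v₁ , w₁) ∷ Γ₁ → n ≤ w₁ → v₁ ≡ Y ⊎ v₁ ≡ Z → ¬ Any (Touch v₁) Γ₁ → YZ ∉ Γ
    YZ∉ Γ↭ n≤w₁ v₁∈YZ lonely YZ∈Γ with ∈-resp-↭ Γ↭ YZ∈Γ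
    ... | here YZ≡e₁ = ≤⇒≯ n≤w₁ (subst (_< n) (cong proj₂ YZ≡e₁) YZ-old)
    ... | there YZ∈Γ₁ = lonely (lose YZ∈Γ₁ (YZ-touch v₁∈YZ))

    twoInnerEdges : ∀ Γ → EdgeGuardSet G Γ → Xa ∉ Γ → ¬ Any (Touch X) Γ →
                    ∀ {v₁ w₁ v₂ w₂ Γ₁ Γ₂} → Γ ↭ (v₁ , w₁) ∷ Γ₁ → Γ₁ ↭ (v₂ , w₂) ∷ Γ₂ →
                    n ≤ w₁ → n ≤ w₂ → v₁ ≡ Y ⊎ v₁ ≡ Z → ¬ Any (Touch v₁) Γ₁ →
                    Improvable n X Corner G Γ
    twoInnerEdges Γ egs Xa∉Γ X∉Γ {v₁} {w₁} {v₂} {w₂} {Γ₂ = Γ₂} Γ↭ Γ₁↭ n≤w₁ n≤w₂ v₁∈YZ lonely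
      with v₂ <? n
    ... | no v₂≮n = replaceOne Γ egs Xa∉Γ _ _ Γ↭₂₁ (oldEnds-new n≤w₂ (⊥-elim ∘ v₂≮n))
      where
      Γ↭₂₁ : Γ ↭ (v₂ , w₂) ∷ (v₁ , w₁) ∷ Γ₂
      Γ↭₂₁ = ↭-trans Γ↭ (↭-trans (↭-prep _ Γ₁↭) (↭-swap _ _ ↭-refl))
    ... | yes v₂<n = replaceTwo Γ egs Xa∉Γ (YZ∉ Γ↭ n≤w₁ v₁∈YZ lonely) _ _ Γ₂ Γ↭₁₂
                       (oldEnds-new n≤w₁ (λ _ → here (YZ-touch v₁∈YZ)) ∷
                        oldEnds-new n≤w₂ (λ _ → here (YZ-touch v₂∈YZ)) ∷ [])
      where
      Γ↭₁₂ : Γ ↭ (v₁ , w₁) ∷ (v₂ , w₂) ∷ Γ₂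
      Γ↭₁₂ = ↭-trans Γ↭ (↭-prep _ Γ₁↭)
      e₂∈Γ : (v₂ , w₂) ∈ Γ
      e₂∈Γ = ∈-resp-↭ (↭-sym Γ↭₁₂) (there (here refl))
      v₂≢X : v₂ ≢ X
      v₂≢X v₂≡X = X∉Γ (lose e₂∈Γ (inj₁ (sym v₂≡X)))
      v₂∈YZ : v₂ ≡ Y ⊎ v₂ ≡ Z
      v₂∈YZ = cornerYZ Γ egs e₂∈Γ n≤w₂ v₂<n v₂≢X

    lonelyCorner : ∀ Γ → EdgeGuardSet G Γ → Xa ∉ Γ → ∀ {v₁ w₁ Γ₁} → (v₁ , w₁) ∈ Γ → n ≤ w₁ →
                   Γ ↭ (v₁ , w₁) ∷ Γ₁ → v₁ < n → v₁ ≢ X → ¬ Any (Touch v₁) Γ₁ →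
                   Improvable n X Corner G Γ
    lonelyCorner Γ egs@(_ , edges , _) Xa∉Γ e₁∈Γ n≤w₁ Γ↭ v₁<n v₁≢X lonely
      with cornerYZ Γ egs e₁∈Γ n≤w₁ v₁<n v₁≢X | any? (touch? X) Γ
    ... | v₁∈YZ | yes X-in = keep Γ egs X-in e₁∈Γ (inj₂ v₁∈YZ) (proj₁ (newEdge (All.lookup edges e₁∈Γ) n≤w₁))
    ... | v₁∈YZ | no X∉Γ with secondInnerEdge Γ egs X∉Γ e₁∈Γ v₁<n v₁≢X
    ... | e₂ , e₂∈Γ , e₂≢e₁ , n≤w₂ with extract (∈-tail Γ↭ e₂∈Γ e₂≢e₁)
    ... | Γ₂ , Γ₁↭ = twoInnerEdges Γ egs Xa∉Γ X∉Γ Γ↭ Γ₁↭ n≤w₁ n≤w₂ v₁∈YZ lonely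

    fromInnerEdge : ∀ Γ → EdgeGuardSet G Γ → Xa ∉ Γ → ∀ {v₁ w₁} → (v₁ , w₁) ∈ Γ → n ≤ w₁ →
                    Improvable n X Corner G Γ
    fromInnerEdge Γ egs Xa∉Γ {v₁} e₁∈Γ n≤w₁ with extract e₁∈Γ
    ... | Γ₁ , Γ↭ with v₁ <? n | any? (touch? v₁) (Xa ∷ Γ₁)
    ... | no v₁≮n | _ = replaceOne Γ egs Xa∉Γ _ Γ₁ Γ↭ (oldEnds-new n≤w₁ (⊥-elim ∘ v₁≮n))
    ... | _ | yes covered = replaceOne Γ egs Xa∉Γ _ Γ₁ Γ↭ (oldEnds-new n≤w₁ (λ _ → covered))
    ... | yes v₁<n | no uncovered =
      lonelyCorner Γ egs Xa∉Γ e₁∈Γ n≤w₁ Γ↭ v₁<n (uncovered ∘ here ∘ inj₁) (uncovered ∘ there)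

    improve : ∀ Γ → EdgeGuardSet G Γ → Improvable n X Corner G Γ
    improve Γ egs@(_ , edges , guarded) with any? (Xa ≟e_) Γ
    ... | yes Xa∈Γ = keep Γ egs (lose Xa∈Γ (inj₁ refl)) Xa∈Γ isX isA
    ... | no Xa∉Γ with find (All.lookup guarded (there (there (here refl))))
    ... | (v₁ , w₁) , e₁∈Γ , g = fromInnerEdge Γ egs Xa∉Γ e₁∈Γ (guard-bac (proj₁ (All.lookup edges e₁∈Γ)) g)

lemma5 : ∀ (n : ℕ) (H : List Tri) → Stacked n H →
         ∀ (x y z : ℕ) (t : Tri) (R : List Tri) → H ↭ (t ∷ R) →
         triList t ↭ (x ∷ y ∷ z ∷ []) →
         ∃[ G ] (AddThreeInside n t R G × Stacked (n + 3) G ×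
           (∀ (Γ : List Edge) → EdgeGuardSet G Γ →
             ∃[ Γ' ] (EdgeGuardSet G Γ' × length Γ' ≡ length Γ × x ∈V Γ' ×
               ∃[ v ] ∃[ w ] ((v ≡ x ⊎ v ≡ y ⊎ v ≡ z) ×
                 (w ≡ n ⊎ w ≡ suc n ⊎ w ≡ suc (suc n)) ×
                 ((v , w) ∈ Γ' ⊎ (w , v) ∈ Γ')))))
lemma5 n H stackedH x y z t R H↭ t↭ with All-resp-↭ H↭ (wellFormed stackedH)
... | wf-t ∷ wf-R with rotateTo t (∈⇒∈t t (∈-resp-↭ (↭-sym t↭) (here refl)))
... | Y , Z , ρ with rotation-wellFormed ρ wf-t
... | x<n , Y<n , Z<n , _ , Y≢Z , _ =
  D ++ R , (stackFaces a t , D₂ , D , stack-into a t , stack-b (rotation-stackFaces ρ) , stack-c , refl) ,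
  stackedG , λ Γ egs → Improvable-mono {Γ = Γ} corner (improve Γ egs)
  where
  open Configuration n x Y Z
  open Guarding R x<n Y<n Z<n Y≢Z (All.map (λ {s} → wellFormed⇒old s) wf-R)

  stackedG : Stacked (n + 3) (D ++ R)
  stackedG = subst (λ m → Stacked m (D ++ R)) (+-comm 3 n)
    (step (step (step stackedH (Stack-resp-↭ H↭ (Stack-++ R (stack-into a t))))
                (Stack-++ R (stack-b (rotation-stackFaces ρ))))
          (Stack-++ R stack-c))

  corner : ∀ {u} → u ∈t (x , Y , Z) → u ∈t (x , y , z)
  corner u∈ = ∈⇒∈t (x , y , z) (∈-resp-↭ t↭ (∈t⇒∈ t (rotation-vertex ρ u∈)))
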